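{- For every $n\geq1$, the map $F$ restricts to a bijection from $\mathcal{C}_{n+1}$ to $\mathcal{S}_n$.
   Context: $\mathcal{S}_n$ is the set of permutations of $[n]=\{1,\dots,n\}$ and $\mathcal{C}_n$ is the set of cyclic permutations of $[n]$ (permutations consisting of a single $n$-cycle). A total cyclic order on a finite set $X$ is a set $Z$ of triples of distinct elements of $X$ such that: $(x,y,z)\in Z\Rightarrow (y,z,x)\in Z$; $(x,y,z)\in Z\Rightarrow (z,y,x)\notin Z$; $(x,y,z)\in Z$ and $(x,z,u)\in Z\Rightarrow (x,y,u)\in Z$; and for any three distinct $x,y,z$, either $(x,y,z)\in Z$ or $(z,y,x)\in Z$. For $\pi\in\mathcal{C}_m$ ($m\geq3$), $\zeta(\pi)$ is the total cyclic order on $[m]$ with $(i_1,i_2,i_3)\in\zeta(\pi)$ iff $i_2=\pi^k(i_1)$ and $i_3=\pi^\ell(i_1)$ for some $1\leq k<\ell\leq m-1$. For a total cyclic order $Z$ and distinct $a,b$, $c_Z(a,b)=\#\{x:(a,x,b)\in Z\}$. For $m\geq3$, $\partial:\mathcal{C}_m\to\mathcal{C}_{m-1}$ deletes $m$ from the cycle: $\partial(\pi)(i)=\pi(i)$ if $\pi(i)\neq m$ and $\partial(\pi)(i)=\pi(m)$ if $\pi(i)=m$. For $\tau\in\mathcal{S}_{n-1}$ and $a\in[n]$, let $D^{ -1}(\tau,a)$ be the unique $\sigma\in\mathcal{S}_n$ with $\sigma(n)=a$ and, for $1\leq i\leq n-1$, $\sigma(i)=\tau(i)$ if $\tau(i)<a$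 and $\sigma(i)=\tau(i)+1$ if $\tau(i)\geq a$. The map $F:\bigsqcup_{n\geq1}\mathcal{C}_{n+1}\to\bigsqcup_{n\geq1}\mathcal{S}_n$ is defined inductively: $F$ sends the unique element of $\mathcal{C}_2$ to the unique element of $\mathcal{S}_1$; for $n\geq2$ and $\pi\in\mathcal{C}_{n+1}$, let $\tilde\sigma=F(\partial(\pi))\in\mathcal{S}_{n-1}$, $\beta=c_{\zeta(\pi)}(n,n+1)$, $\alpha=n-\beta$ if $n$ is even and $\alpha=1+\beta$ if $n$ is odd, and set $F(\pi)=D^{ -1}(\tilde\sigma,\alpha)$. -}

module Defs where

open import Data.Nat using (ℕ; zero; suc; _∸_; _+_; _≤_; _<_; _%_)
open import Data.Nat.Properties using (_≟_)
open import Data.Fin using (Fin; zero; suc; toℕ; fromℕ; fromℕ<; inject₁; lower₁; punchIn)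
open import Data.Fin.Properties using (any?)
open import Data.Nat.Properties as ℕP using ()
open import Data.Vec using (allFin; count)
open import Data.Product using (Σ; ∃; _×_; _,_)
open import Relation.Nullary using (Dec; yes; no; ¬_)
open import Relation.Nullary.Decidable using (_×-dec_)
open import Relation.Binary.PropositionalEquality using (_≡_; refl)
open import Function.Definitions using (Bijective)

-- Permutations of [m] are represented as functions Fin m → Fin m
-- (element i : Fin m stands for toℕ i + 1 ∈ [m]).

iter : ∀ {m} → (Fin m → Fin m) → ℕ → Fin m → Fin m
iter π zero    x = x
iter π (suc k) x = π (iter π k x)

IsPerm : ∀ {m} → (Fin m → Fin m) → Set
IsPerm {m} σ = Bijective {A = Fin m} {B = Fin m} _≡_ _≡_ σ

-- π ∈ C_m : π is a permutation consisting of a single m-cycle,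
-- i.e. every j lies in the π-orbit of every i.
IsCyclic : ∀ {m} → (Fin m → Fin m) → Set
IsCyclic π = IsPerm π × (∀ i j → ∃ λ k → iter π k i ≡ j)

-- ζ(π): (i₁,i₂,i₃) ∈ ζ(π) iff i₂ = π^k(i₁), i₃ = π^ℓ(i₁) for some 1 ≤ k < ℓ ≤ m-1
-- (k, ℓ range over Fin m, i.e. 0 ≤ k, ℓ ≤ m-1).
ζ : ∀ {m} → (Fin m → Fin m) → Fin m → Fin m → Fin m → Set
ζ {m} π i₁ i₂ i₃ =
  ∃ λ (k : Fin m) → ∃ λ (l : Fin m) →
    (1 ≤ toℕ k) × (toℕ k < toℕ l) × (iter π (toℕ k) i₁ ≡ i₂) × (iter π (toℕ l) i₁ ≡ i₃)

ζ? : ∀ {m} (π : Fin m → Fin m) i₁ i₂ i₃ → Dec (ζ π i₁ i₂ i₃)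
ζ? π i₁ i₂ i₃ = any? λ k → any? λ l →
  (1 ℕP.≤? toℕ k) ×-dec ((toℕ k ℕP.<? toℕ l) ×-dec
    ((iter π (toℕ k) i₁ Data.Fin.≟ i₂) ×-dec (iter π (toℕ l) i₁ Data.Fin.≟ i₃)))

cζ : ∀ {m} → (Fin m → Fin m) → Fin m → Fin m → ℕ
cζ π a b = count (λ x → ζ? π a x b) (allFin _)

-- ∂ : delete the largest element (index fromℕ m) from the cycle.
-- (The fallback branch, where π(last) = last too, never occurs for cycles of length ≥ 2.)
∂ : ∀ {m} → (Fin (suc m) → Fin (suc m)) → Fin m → Fin m
∂ {m} π i with m ≟ toℕ (π (inject₁ i))
... | no ne = lower₁ (π (inject₁ i)) ne
... | yes _ with m ≟ toℕ (π (fromℕ m))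
...   | no ne' = lower₁ (π (fromℕ m)) ne'
...   | yes _  = i

-- D⁻¹(τ, a) with a given 0-based (a = toℕ a' + 1):
-- σ(n) = a, and σ(i) = τ(i) if τ(i) < a, τ(i)+1 otherwise (this is punchIn).
Dinv : ∀ {n} → (Fin n → Fin n) → Fin (suc n) → Fin (suc n) → Fin (suc n)
Dinv {n} τ a' i with n ≟ toℕ i
... | yes _ = a'
... | no ne = punchIn a' (τ (lower₁ i ne))

-- convert a 1-based value α ∈ [n] to Fin n (clamped; clamping never
-- triggers for cyclic inputs)
toIdx : ∀ n → ℕ → Fin (suc n)
toIdx n α with (α ∸ 1) ℕP.<? suc n
... | yes p = fromℕ< p
... | no _  = fromℕ n

F : (n : ℕ) → (Fin (suc n) → Fin (suc n)) → Fin n → Fin n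
F zero          π ()
F (suc zero)    π i = i
F (suc (suc k)) π = Dinv (F (suc k) (∂ π)) (toIdx (suc k) α)
  where
    n : ℕ
    n = suc (suc k)
    -- β = c_{ζ(π)}(n, n+1); 0-based indices n-1 and n
    β : ℕ
    β = cζ π (inject₁ (fromℕ (suc k))) (fromℕ n)
    α : ℕ
    α with n % 2 ≟ 0
    ... | yes _ = n ∸ β
    ... | no _  = 1 + β

module Submission where

-- A cycle π on [n+1] is determined by ∂π together with the place where n+1 sits in it, and n+1
-- may sit right after any of the n elements of ∂π.  That place is recorded by the distance d from
-- n to n+1 along π, and β = c(n, n+1) = d − 1 counts the elements strictly between them, so
-- π ↦ (∂π, β) is a bijection from C_{n+1} onto C_n × {0, …, n−1}.  As β ↦ α is a bijection
-- {0, …, n−1} → [n] and D⁻¹ : S_{n−1} × [n] → S_n is a bijection, F(π) = D⁻¹(F(∂π), α) makes F a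
-- bijection C_{n+1} → S_n by induction on n.

open import Defs
open import Data.Bool using (true; false; if_then_else_)
open import Data.Nat using (ℕ; zero; suc; _+_; _∸_; _≤_; _<_; _%_; z≤n; s≤s; s≤s⁻¹)
import Data.Nat.Properties as ℕₚ
open import Data.Fin using (Fin; zero; suc; toℕ; fromℕ; fromℕ<; inject₁; lower₁; punchIn; punchOut; _≟_)
import Data.Fin.Properties as Finₚ
open import Data.Fin.Relation.Unary.Top using (view; ‵fromℕ; ‵inject₁; view-fromℕ; view-inject₁)
open import Data.Vec using (tabulate; allFin; count)
open import Data.Product using (∃; _×_; _,_; proj₁; proj₂)
open import Data.Sum using (_⊎_; inj₁; inj₂)
open import Function using (_∘_; id)
open import Function.Bundles using (_⇔_; mk⇔)
open import Function.Definitions using (Injective)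
open import Relation.Nullary using (yes; no; ¬_; does; contradiction)
open import Relation.Nullary.Decidable using (_×-dec_; dec-true; dec-false; does-⇔)
open import Relation.Unary using (Pred; Decidable)
open import Relation.Binary using (tri<; tri≈; tri>)
open import Relation.Binary.PropositionalEquality
open ≡-Reasoning

inject₁≢fromℕ : ∀ {m} (x : Fin m) → inject₁ x ≢ fromℕ m
inject₁≢fromℕ x = Finₚ.fromℕ≢inject₁ ∘ sym

toℕ≡⇒≡fromℕ : ∀ {m} {y : Fin (suc m)} → m ≡ toℕ y → y ≡ fromℕ m
toℕ≡⇒≡fromℕ {m} e = Finₚ.toℕ-injective (trans (sym e) (sym (Finₚ.toℕ-fromℕ m)))

≡fromℕ⇒toℕ≡ : ∀ {m} {y : Fin (suc m)} → y ≡ fromℕ m → m ≡ toℕ y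
≡fromℕ⇒toℕ≡ {m} refl = sym (Finₚ.toℕ-fromℕ m)

lower₁-cong : ∀ {m} {y y′ : Fin (suc m)} (ne : m ≢ toℕ y) (ne′ : m ≢ toℕ y′) → y ≡ y′ →
              lower₁ y ne ≡ lower₁ y′ ne′
lower₁-cong ne ne′ refl = Finₚ.lower₁-irrelevant _ ne ne′

injective⇒surjective : ∀ {m} {f : Fin m → Fin m} → Injective _≡_ _≡_ f → ∀ y → ∃ λ x → f x ≡ y
injective⇒surjective {suc m} {f} f-inj y with Finₚ.any? (λ x → f x ≟ y)
... | yes hit = hit
... | no miss = contradiction (Finₚ.injective⇒≤ g-inj) ℕₚ.1+n≰n
  where
  g : Fin (suc m) → Fin m
  g x = punchOut {i = y} (λ y≡fx → miss (x , sym y≡fx))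
  g-inj : Injective _≡_ _≡_ g
  g-inj e = f-inj (Finₚ.punchOut-injective {i = y} _ _ e)

injective⇒isPerm : ∀ {m} {f : Fin m → Fin m} → Injective _≡_ _≡_ f → IsPerm f
injective⇒isPerm f-inj = f-inj , λ y → let x , fx≡y = injective⇒surjective f-inj y in x , λ { refl → fx≡y }

module _ {m} (f : Fin m → Fin m) where

  Reaches : Fin m → Fin m → Set
  Reaches x y = ∃ λ k → iter f k x ≡ y

  reaches-refl : ∀ {x} → Reaches x x
  reaches-refl = 0 , refl

  reaches-step : ∀ {x y} → f x ≡ y → Reaches x y
  reaches-step fx≡y = 1 , fx≡y

  iter-+ : ∀ i j x → iter f (i + j) x ≡ iter f i (iter f j x)
  iter-+ zero    j x = refl
  iter-+ (suc i) j x = cong f (iter-+ i j x)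

  reaches-trans : ∀ {x y z} → Reaches x y → Reaches y z → Reaches x z
  reaches-trans (i , refl) (j , refl) = j + i , iter-+ j i _

  iter-sucʳ : ∀ k x → iter f (suc k) x ≡ iter f k (f x)
  iter-sucʳ zero    x = refl
  iter-sucʳ (suc k) x = cong f (iter-sucʳ k x)

  iter-fixed : ∀ {x} → f x ≡ x → ∀ k → iter f k x ≡ x
  iter-fixed fx≡x zero    = refl
  iter-fixed fx≡x (suc k) = trans (cong f (iter-fixed fx≡x k)) fx≡x

  iter-injective : Injective _≡_ _≡_ f → ∀ k → Injective _≡_ _≡_ (iter f k)
  iter-injective f-inj zero    e = e
  iter-injective f-inj (suc k) e = iter-injective f-inj k (f-inj e)

iter-cong : ∀ {m} {f g : Fin m → Fin m} → f ≗ g → ∀ k → iter f k ≗ iter g k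
iter-cong         f≗g zero    x = refl
iter-cong {f = f} f≗g (suc k) x = trans (cong f (iter-cong f≗g k x)) (f≗g _)

isCyclic-resp-≗ : ∀ {m} {f g : Fin m → Fin m} → f ≗ g → IsCyclic f → IsCyclic g
isCyclic-resp-≗ f≗g ((f-inj , _) , f-reaches) =
  injective⇒isPerm (λ e → f-inj (trans (f≗g _) (trans e (sym (f≗g _))))) ,
  λ x y → let k , e = f-reaches x y in k , trans (sym (iter-cong f≗g k x)) e

module _ {a p q} {A : Set a} {P : Pred A p} {Q : Pred A q} (P? : Decidable P) (Q? : Decidable Q) where

  count-cong : ∀ {N} (f : Fin N → A) → (∀ i → P (f i) ⇔ Q (f i)) →
               count P? (tabulate f) ≡ count Q? (tabulate f)
  count-cong {zero}  f P⇔Q = refl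
  count-cong {suc N} f P⇔Q =
    cong₂ (λ b → if b then suc else id) (does-⇔ (P⇔Q zero) (P? (f zero)) (Q? (f zero)))
          (count-cong (f ∘ suc) (P⇔Q ∘ suc))

  count-insert : ∀ {N} (f : Fin N → A) y → ¬ P (f y) → Q (f y) →
                 (∀ i → i ≢ y → P (f i) ⇔ Q (f i)) →
                 count Q? (tabulate f) ≡ suc (count P? (tabulate f))
  count-insert f zero ¬Py Qy P⇔Q
    rewrite dec-false (P? (f zero)) ¬Py | dec-true (Q? (f zero)) Qy =
    cong suc (sym (count-cong (f ∘ suc) (λ i → P⇔Q (suc i) λ ())))
  count-insert f (suc y) ¬Py Qy P⇔Q
    with IH ← count-insert (f ∘ suc) y ¬Py Qy (λ i i≢y → P⇔Q (suc i) (i≢y ∘ Finₚ.suc-injective))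
    rewrite sym (does-⇔ (P⇔Q zero λ ()) (P? (f zero)) (Q? (f zero)))
    with does (P? (f zero))
  ... | true  = cong suc IH
  ... | false = IH

count-none : ∀ {a p} {A : Set a} {P : Pred A p} (P? : Decidable P) {N} (f : Fin N → A) →
             (∀ i → ¬ P (f i)) → count P? (tabulate f) ≡ 0
count-none P? {zero}  f ¬P = refl
count-none P? {suc N} f ¬P rewrite dec-false (P? (f zero)) (¬P zero) = count-none P? (f ∘ suc) (¬P ∘ suc)

cover⇒≤ : ∀ {N p} (g : ℕ → Fin N) → (∀ y → ∃ λ r → r < p × g r ≡ y) → N ≤ p
cover⇒≤ {N} {p} g cover = Finₚ.injective⇒≤ index-injective
  where
  index : Fin N → Fin p
  index y = let _ , r<p , _ = cover y in fromℕ< r<p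
  index-injective : Injective _≡_ _≡_ index
  index-injective {y₁} {y₂} e =
    let r₁ , r₁<p , g₁ = cover y₁
        r₂ , r₂<p , g₂ = cover y₂
        r₁≡r₂ = trans (sym (Finₚ.toℕ-fromℕ< r₁<p)) (trans (cong toℕ e) (Finₚ.toℕ-fromℕ< r₂<p))
    in trans (sym g₁) (trans (cong g r₁≡r₂) g₂)

-- Cycles

ζ-cong : ∀ {N} {π π′ : Fin N → Fin N} → π ≗ π′ → ∀ {a x b} → ζ π a x b → ζ π′ a x b
ζ-cong π≗π′ (k , l , 1≤k , k<l , e₁ , e₂) =
  k , l , 1≤k , k<l , trans (sym (iter-cong π≗π′ (toℕ k) _)) e₁
                    , trans (sym (iter-cong π≗π′ (toℕ l) _)) e₂

cζ-cong : ∀ {N} {π π′ : Fin N → Fin N} → π ≗ π′ → ∀ a b → cζ π a b ≡ cζ π′ a b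
cζ-cong π≗π′ a b = count-cong (λ x → ζ? _ a x b) (λ x → ζ? _ a x b) id
                              (λ _ → mk⇔ (ζ-cong π≗π′) (ζ-cong (sym ∘ π≗π′)))

module Cycle {N} {π : Fin N → Fin N} (π-cyclic : IsCyclic π) where

  injective : Injective _≡_ _≡_ π
  injective = proj₁ (proj₁ π-cyclic)

  reaches : ∀ x y → Reaches π x y
  reaches = proj₂ π-cyclic

  no-fixed-point : ∀ {x y} → x ≢ y → π x ≢ x
  no-fixed-point {x} {y} x≢y πx≡x = let k , e = reaches x y in x≢y (trans (sym (iter-fixed π πx≡x k)) e)

  orbit-index-mod : ∀ {a p} → 1 ≤ p → iter π p a ≡ a → ∀ y → ∃ λ r → r < p × iter π r a ≡ y
  orbit-index-mod {a} {p} 1≤p period y =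
    let k , e = reaches a y ; r , r<p , e′ = reduce k in r , r<p , trans (sym e′) e
    where
    reduce : ∀ k → ∃ λ r → r < p × iter π k a ≡ iter π r a
    reduce zero = 0 , 1≤p , refl
    reduce (suc k) with reduce k
    ... | r , r<p , e with suc r ℕₚ.<? p
    ...   | yes 1+r<p = suc r , 1+r<p , cong π e
    ...   | no  1+r≮p = 0 , 1≤p , trans (cong π e)
                          (trans (cong (λ c → iter π c a) (ℕₚ.≤-antisym r<p (ℕₚ.≮⇒≥ 1+r≮p))) period)

  repeat⇒period : ∀ {a i j} → i < j → iter π i a ≡ iter π j a → iter π (j ∸ i) a ≡ a
  repeat⇒period {a} {i} {j} i<j e = sym (iter-injective π injective i (begin
    iter π i a                  ≡⟨ e ⟩
    iter π j a                  ≡⟨ cong (λ c → iter π c a) (sym (ℕₚ.m+[n∸m]≡n (ℕₚ.<⇒≤ i<j))) ⟩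
    iter π (i + (j ∸ i)) a      ≡⟨ iter-+ π i (j ∸ i) a ⟩
    iter π i (iter π (j ∸ i) a) ∎))

  iter-distinct : ∀ {a i j} → i < j → j < N → iter π i a ≢ iter π j a
  iter-distinct {a} {i} {j} i<j j<N e =
    ℕₚ.<⇒≱ (ℕₚ.≤-<-trans (ℕₚ.m∸n≤m j i) j<N)
           (cover⇒≤ (λ r → iter π r a) (orbit-index-mod (ℕₚ.m<n⇒0<n∸m i<j) (repeat⇒period i<j e)))

  orbit-index : ∀ a b → ∃ λ d → d < N × iter π d a ≡ b
  orbit-index a b
    with i , j , i<j , e ← Finₚ.pigeonhole (ℕₚ.n<1+n N) (λ (i : Fin (suc N)) → iter π (toℕ i) a) =
    let r , r<p , e′ = orbit-index-mod (ℕₚ.m<n⇒0<n∸m i<j) (repeat⇒period i<j e) b in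
    r , ℕₚ.<-≤-trans r<p (ℕₚ.≤-trans (ℕₚ.m∸n≤m (toℕ j) (toℕ i)) (s≤s⁻¹ (Finₚ.toℕ<n j))) , e′

  orbit-index-unique : ∀ {a d d′} → d < N → d′ < N → iter π d a ≡ iter π d′ a → d ≡ d′
  orbit-index-unique {d = d} {d′} d<N d′<N e with ℕₚ.<-cmp d d′
  ... | tri< d<d′ _ _ = contradiction e (iter-distinct d<d′ d′<N)
  ... | tri≈ _ d≡d′ _ = d≡d′
  ... | tri> _ _ d′<d = contradiction (sym e) (iter-distinct d′<d d<N)

  Arc : Fin N → ℕ → Pred (Fin N) _
  Arc a e x = ∃ λ (k : Fin N) → 1 ≤ toℕ k × toℕ k < e × iter π (toℕ k) a ≡ x

  arc? : ∀ a e → Decidable (Arc a e)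
  arc? a e x = Finₚ.any? λ k → (1 ℕₚ.≤? toℕ k) ×-dec ((toℕ k ℕₚ.<? e) ×-dec (iter π (toℕ k) a ≟ x))

  count-arc : ∀ a e → suc e < N → count (arc? a (suc e)) (allFin N) ≡ e
  count-arc a zero _ = count-none (arc? a 1) id λ _ (_ , 1≤k , k<1 , _) → ℕₚ.<⇒≱ k<1 1≤k
  count-arc a (suc e) 2+e<N =
    trans (count-insert (arc? a (suc e)) (arc? a (suc (suc e))) id y y∉arc y∈arc′ same)
          (cong suc (count-arc a e 1+e<N))
    where
    1+e<N : suc e < N
    1+e<N = ℕₚ.<-trans (ℕₚ.n<1+n (suc e)) 2+e<N
    y : Fin N
    y = iter π (suc e) a
    y∉arc : ¬ Arc a (suc e) y
    y∉arc (k , _ , k<1+e , πᵏa≡y) = iter-distinct k<1+e 1+e<N πᵏa≡y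
    y∈arc′ : Arc a (suc (suc e)) y
    y∈arc′ = fromℕ< 1+e<N , subst (1 ≤_) (sym t) (s≤s z≤n) , subst (_< suc (suc e)) (sym t) ℕₚ.≤-refl ,
             cong (λ c → iter π c a) t
      where t = Finₚ.toℕ-fromℕ< 1+e<N
    same : ∀ x → x ≢ y → Arc a (suc e) x ⇔ Arc a (suc (suc e)) x
    same x x≢y = mk⇔ (λ (k , 1≤k , k<1+e , πᵏa≡x) → k , 1≤k , ℕₚ.m<n⇒m<1+n k<1+e , πᵏa≡x) narrow
      where
      narrow : Arc a (suc (suc e)) x → Arc a (suc e) x
      narrow (k , 1≤k , k<2+e , πᵏa≡x) with ℕₚ.m<1+n⇒m<n∨m≡n k<2+e
      ... | inj₁ k<1+e = k , 1≤k , k<1+e , πᵏa≡x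
      ... | inj₂ k≡1+e = contradiction (trans (sym πᵏa≡x) (cong (λ c → iter π c a) k≡1+e)) x≢y

  cζ-orbit : ∀ {a b d} → suc d < N → iter π (suc d) a ≡ b → cζ π a b ≡ d
  cζ-orbit {a} {b} {d} 1+d<N πᵈ⁺¹a≡b =
    trans (count-cong (λ x → ζ? π a x b) (arc? a (suc d)) id (λ _ → mk⇔ to from)) (count-arc a d 1+d<N)
    where
    to : ∀ {x} → ζ π a x b → Arc a (suc d) x
    to (k , l , 1≤k , k<l , e₁ , e₂) =
      k , 1≤k , subst (toℕ k <_) (orbit-index-unique (Finₚ.toℕ<n l) 1+d<N (trans e₂ (sym πᵈ⁺¹a≡b))) k<l , e₁
    from : ∀ {x} → Arc a (suc d) x → ζ π a x b
    from (k , 1≤k , k<1+d , e₁) =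
      k , fromℕ< 1+d<N , 1≤k , subst (toℕ k <_) (sym t) k<1+d , e₁ , trans (cong (λ c → iter π c a) t) πᵈ⁺¹a≡b
      where t = Finₚ.toℕ-fromℕ< 1+d<N

cycles-on-Fin2-coincide : ∀ {π π′ : Fin 2 → Fin 2} → IsCyclic π → IsCyclic π′ → π ≗ π′
cycles-on-Fin2-coincide π-cyclic π′-cyclic x = other-point (moves π-cyclic x) (moves π′-cyclic x)
  where
  moves : ∀ {π : Fin 2 → Fin 2} → IsCyclic π → ∀ x → π x ≢ x
  moves π-cyclic zero       = Cycle.no-fixed-point π-cyclic {y = suc zero} (λ ())
  moves π-cyclic (suc zero) = Cycle.no-fixed-point π-cyclic {y = zero} (λ ())
  other-point : ∀ {x y z : Fin 2} → y ≢ x → z ≢ x → y ≡ z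
  other-point {zero}     {suc zero} {suc zero} _   _   = refl
  other-point {suc zero} {zero}     {zero}     _   _   = refl
  other-point {zero}     {zero}                y≢x _   = contradiction refl y≢x
  other-point {suc zero} {suc zero}            y≢x _   = contradiction refl y≢x
  other-point {zero}     {suc zero} {zero}     _   z≢x = contradiction refl z≢x
  other-point {suc zero} {zero}     {suc zero} _   z≢x = contradiction refl z≢x

-- The map D⁻¹

module _ {n} (τ : Fin n → Fin n) (a : Fin (suc n)) where

  Dinv-fromℕ : Dinv τ a (fromℕ n) ≡ a
  Dinv-fromℕ with n ℕₚ.≟ toℕ (fromℕ n)
  ... | yes _ = refl
  ... | no ne = contradiction (sym (Finₚ.toℕ-fromℕ n)) ne

  Dinv-inject₁ : ∀ x → Dinv τ a (inject₁ x) ≡ punchIn a (τ x)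
  Dinv-inject₁ x with n ℕₚ.≟ toℕ (inject₁ x)
  ... | yes e = contradiction e (Finₚ.toℕ-inject₁-≢ x)
  ... | no ne = cong (punchIn a ∘ τ) (Finₚ.lower₁-inject₁′ x ne)

  Dinv-injective : Injective _≡_ _≡_ τ → Injective _≡_ _≡_ (Dinv τ a)
  Dinv-injective τ-inj {y₁} {y₂} e with view y₁ | view y₂
  ... | ‵fromℕ      | ‵fromℕ      = refl
  ... | ‵fromℕ      | ‵inject₁ x₂ =
    contradiction (trans (sym (Dinv-inject₁ x₂)) (trans (sym e) Dinv-fromℕ)) (Finₚ.punchInᵢ≢i a (τ x₂))
  ... | ‵inject₁ x₁ | ‵fromℕ      =
    contradiction (trans (sym (Dinv-inject₁ x₁)) (trans e Dinv-fromℕ)) (Finₚ.punchInᵢ≢i a (τ x₁))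
  ... | ‵inject₁ x₁ | ‵inject₁ x₂ = cong inject₁ (τ-inj (Finₚ.punchIn-injective a _ _
    (trans (sym (Dinv-inject₁ x₁)) (trans e (Dinv-inject₁ x₂)))))

Dinv-cong : ∀ {n} {τ τ′ : Fin n → Fin n} {a a′} → τ ≗ τ′ → a ≡ a′ → Dinv τ a ≗ Dinv τ′ a′
Dinv-cong {n} {τ} {τ′} {a} τ≗τ′ refl y with view y
... | ‵fromℕ     = trans (Dinv-fromℕ τ a) (sym (Dinv-fromℕ τ′ a))
... | ‵inject₁ x = trans (Dinv-inject₁ τ a x) (trans (cong (punchIn a) (τ≗τ′ x)) (sym (Dinv-inject₁ τ′ a x)))

Dinv-cancel : ∀ {n} {τ τ′ : Fin n → Fin n} {a a′} → Dinv τ a ≗ Dinv τ′ a′ → τ ≗ τ′ × a ≡ a′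
Dinv-cancel {n} {τ} {τ′} {a} {a′} D≗D′ = τ≗τ′ , a≡a′
  where
  a≡a′ : a ≡ a′
  a≡a′ = trans (sym (Dinv-fromℕ τ a)) (trans (D≗D′ _) (Dinv-fromℕ τ′ a′))
  τ≗τ′ : τ ≗ τ′
  τ≗τ′ x = Finₚ.punchIn-injective a _ _ (begin
    punchIn a (τ x)        ≡⟨ sym (Dinv-inject₁ τ a x) ⟩
    Dinv τ a (inject₁ x)   ≡⟨ D≗D′ _ ⟩
    Dinv τ′ a′ (inject₁ x) ≡⟨ Dinv-inject₁ τ′ a′ x ⟩
    punchIn a′ (τ′ x)      ≡⟨ cong (λ c → punchIn c (τ′ x)) (sym a≡a′) ⟩
    punchIn a (τ′ x)       ∎)

Dinv-surjective : ∀ {n} {σ : Fin (suc n) → Fin (suc n)} → Injective _≡_ _≡_ σ →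
                  ∃ λ τ → Injective _≡_ _≡_ τ × Dinv τ (σ (fromℕ n)) ≗ σ
Dinv-surjective {n} {σ} σ-inj = τ , τ-inj , Dinv-τ
  where
  top≢ : ∀ x → σ (fromℕ n) ≢ σ (inject₁ x)
  top≢ x e = inject₁≢fromℕ x (sym (σ-inj e))
  τ : Fin n → Fin n
  τ x = punchOut (top≢ x)
  τ-inj : Injective _≡_ _≡_ τ
  τ-inj e = Finₚ.inject₁-injective (σ-inj (Finₚ.punchOut-injective (top≢ _) (top≢ _) e))
  Dinv-τ : Dinv τ (σ (fromℕ n)) ≗ σ
  Dinv-τ y with view y
  ... | ‵fromℕ     = Dinv-fromℕ τ _
  ... | ‵inject₁ x = trans (Dinv-inject₁ τ _ x) (Finₚ.punchIn-punchOut (top≢ x))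

-- Deleting and inserting the largest element

∂-cong : ∀ {m} {π π′ : Fin (suc m) → Fin (suc m)} → π ≗ π′ → ∂ π ≗ ∂ π′
∂-cong {m} {π} {π′} π≗π′ x
  with m ℕₚ.≟ toℕ (π (inject₁ x)) | m ℕₚ.≟ toℕ (π′ (inject₁ x))
... | no ne | no ne′ = lower₁-cong ne ne′ (π≗π′ _)
... | yes e | no ne′ = contradiction (trans e (cong toℕ (π≗π′ _))) ne′
... | no ne | yes e′ = contradiction (trans e′ (cong toℕ (sym (π≗π′ _)))) ne
... | yes _ | yes _ with m ℕₚ.≟ toℕ (π (fromℕ m)) | m ℕₚ.≟ toℕ (π′ (fromℕ m))
...   | no ne | no ne′ = lower₁-cong ne ne′ (π≗π′ _)
...   | yes e | no ne′ = contradiction (trans e (cong toℕ (π≗π′ _))) ne′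
...   | no ne | yes e′ = contradiction (trans e′ (cong toℕ (sym (π≗π′ _)))) ne
...   | yes _ | yes _ = refl

module _ {m} (π : Fin (suc m) → Fin (suc m)) where

  ∂-inject₁ : ∀ x → π (inject₁ x) ≢ fromℕ m → inject₁ (∂ π x) ≡ π (inject₁ x)
  ∂-inject₁ x miss with m ℕₚ.≟ toℕ (π (inject₁ x))
  ... | yes e = contradiction (toℕ≡⇒≡fromℕ e) miss
  ... | no ne = Finₚ.inject₁-lower₁ _ ne

  ∂-skip : ∀ x → π (inject₁ x) ≡ fromℕ m → π (fromℕ m) ≢ fromℕ m → inject₁ (∂ π x) ≡ π (fromℕ m)
  ∂-skip x hit miss with m ℕₚ.≟ toℕ (π (inject₁ x))
  ... | no ne = contradiction (≡fromℕ⇒toℕ≡ hit) ne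
  ... | yes _ with m ℕₚ.≟ toℕ (π (fromℕ m))
  ...   | yes e = contradiction (toℕ≡⇒≡fromℕ e) miss
  ...   | no ne = Finₚ.inject₁-lower₁ _ ne

  iter-∂ : ∀ k x → (∀ i → i ≤ k → iter π i (inject₁ x) ≢ fromℕ m) →
           iter π k (inject₁ x) ≡ inject₁ (iter (∂ π) k x)
  iter-∂ zero    x avoid = refl
  iter-∂ (suc k) x avoid = begin
    π (iter π k (inject₁ x))       ≡⟨ cong π IH ⟩
    π (inject₁ (iter (∂ π) k x))   ≡⟨ sym (∂-inject₁ _ (avoid (suc k) ℕₚ.≤-refl ∘ trans (cong π IH))) ⟩
    inject₁ (∂ π (iter (∂ π) k x)) ∎
    where
    IH : iter π k (inject₁ x) ≡ inject₁ (iter (∂ π) k x)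
    IH = iter-∂ k x (λ i i≤k → avoid i (ℕₚ.m≤n⇒m≤1+n i≤k))

module TopPreimage {m} {π : Fin (suc m) → Fin (suc m)} (π-inj : Injective _≡_ _≡_ π)
                   {j} (πj≡top : π (inject₁ j) ≡ fromℕ m) where

  top-moves : π (fromℕ m) ≢ fromℕ m
  top-moves πtop≡top = inject₁≢fromℕ j (π-inj (trans πj≡top (sym πtop≡top)))

  others-miss-top : ∀ {x} → x ≢ j → π (inject₁ x) ≢ fromℕ m
  others-miss-top x≢j πx≡top = x≢j (Finₚ.inject₁-injective (π-inj (trans πx≡top (sym πj≡top))))

∂-determines : ∀ {m} {π π′ : Fin (suc m) → Fin (suc m)} {j} →
               Injective _≡_ _≡_ π → Injective _≡_ _≡_ π′ → ∂ π ≗ ∂ π′ →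
               π (inject₁ j) ≡ fromℕ m → π′ (inject₁ j) ≡ fromℕ m → π ≗ π′
∂-determines {m} {π} {π′} {j} π-inj π′-inj ∂≗∂′ πj≡top π′j≡top = agree
  where
  module T  = TopPreimage π-inj πj≡top
  module T′ = TopPreimage π′-inj π′j≡top

  agree : π ≗ π′
  agree y with view y
  ... | ‵fromℕ = begin
    π (fromℕ m)       ≡⟨ sym (∂-skip π j πj≡top T.top-moves) ⟩
    inject₁ (∂ π j)   ≡⟨ cong inject₁ (∂≗∂′ j) ⟩
    inject₁ (∂ π′ j)  ≡⟨ ∂-skip π′ j π′j≡top T′.top-moves ⟩
    π′ (fromℕ m)      ∎
  ... | ‵inject₁ x with x ≟ j
  ...   | yes refl = trans πj≡top (sym π′j≡top)
  ...   | no x≢j = begin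
    π (inject₁ x)     ≡⟨ sym (∂-inject₁ π x (T.others-miss-top x≢j)) ⟩
    inject₁ (∂ π x)   ≡⟨ cong inject₁ (∂≗∂′ x) ⟩
    inject₁ (∂ π′ x)  ≡⟨ ∂-inject₁ π′ x (T′.others-miss-top x≢j) ⟩
    π′ (inject₁ x)    ∎

module _ {m} {π : Fin (suc m) → Fin (suc m)} (top-moves : π (fromℕ m) ≢ fromℕ m) where

  ∂-step : ∀ x → π (inject₁ x) ≡ inject₁ (∂ π x)
                 ⊎ (π (inject₁ x) ≡ fromℕ m × π (fromℕ m) ≡ inject₁ (∂ π x))
  ∂-step x with π (inject₁ x) ≟ fromℕ m
  ... | yes hit  = inj₂ (hit , sym (∂-skip π x hit top-moves))
  ... | no miss = inj₁ (sym (∂-inject₁ π x miss))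

  ∂-resp : ∀ {x₁ x₂} → π (inject₁ x₁) ≡ π (inject₁ x₂) → ∂ π x₁ ≡ ∂ π x₂
  ∂-resp {x₁} {x₂} e with ∂-step x₁ | ∂-step x₂
  ... | inj₁ s₁       | inj₁ s₂       = Finₚ.inject₁-injective (trans (sym s₁) (trans e s₂))
  ... | inj₂ (_ , s₁) | inj₂ (_ , s₂) = Finₚ.inject₁-injective (trans (sym s₁) s₂)
  ... | inj₁ s₁       | inj₂ (h₂ , _) = contradiction (trans (sym s₁) (trans e h₂)) (inject₁≢fromℕ _)
  ... | inj₂ (h₁ , _) | inj₁ s₂       = contradiction (trans (sym s₂) (trans (sym e) h₁)) (inject₁≢fromℕ _)

  ∂-injective : Injective _≡_ _≡_ π → Injective _≡_ _≡_ (∂ π)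
  ∂-injective π-inj {x₁} {x₂} e with ∂-step x₁ | ∂-step x₂
  ... | inj₁ s₁       | inj₁ s₂       = Finₚ.inject₁-injective (π-inj (trans s₁ (trans (cong inject₁ e) (sym s₂))))
  ... | inj₂ (h₁ , _) | inj₂ (h₂ , _) = Finₚ.inject₁-injective (π-inj (trans h₁ (sym h₂)))
  ... | inj₁ s₁       | inj₂ (_ , t₂) =
    contradiction (π-inj (trans s₁ (trans (cong inject₁ e) (sym t₂)))) (inject₁≢fromℕ x₁)
  ... | inj₂ (_ , t₁) | inj₁ s₂       =
    contradiction (π-inj (trans s₂ (trans (cong inject₁ (sym e)) (sym t₁)))) (inject₁≢fromℕ x₂)

  reaches-∂-step : ∀ x → Reaches π (inject₁ x) (inject₁ (∂ π x))
  reaches-∂-step x with ∂-step x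
  ... | inj₁ one               = reaches-step π one
  ... | inj₂ (toTop , fromTop) = reaches-trans π (reaches-step π toTop) (reaches-step π fromTop)

  reaches-iter-∂ : ∀ k x → Reaches π (inject₁ x) (inject₁ (iter (∂ π) k x))
  reaches-iter-∂ zero    x = reaches-refl π
  reaches-iter-∂ (suc k) x = reaches-trans π (reaches-iter-∂ k x) (reaches-∂-step _)

  reaches⇒∂-reaches : ∀ k x y → iter π k (inject₁ x) ≡ inject₁ y → Reaches (∂ π) x y
  reaches⇒∂-reaches zero    x y e = 0 , Finₚ.inject₁-injective e
  reaches⇒∂-reaches (suc k) x y e with ∂-step x | k
  ... | inj₁ one | k =
    reaches-trans (∂ π) (reaches-step (∂ π) refl) (reaches⇒∂-reaches k (∂ π x) y (begin
    iter π k (inject₁ (∂ π x))       ≡⟨ cong (iter π k) (sym one) ⟩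
    iter π k (π (inject₁ x))         ≡⟨ sym (iter-sucʳ π k _) ⟩
    iter π (suc k) (inject₁ x)       ≡⟨ e ⟩
    inject₁ y                        ∎))
  ... | inj₂ (toTop , _) | zero = contradiction (trans (sym e) toTop) (inject₁≢fromℕ y)
  ... | inj₂ (toTop , fromTop) | suc k =
    reaches-trans (∂ π) (reaches-step (∂ π) refl) (reaches⇒∂-reaches k (∂ π x) y (begin
    iter π k (inject₁ (∂ π x))       ≡⟨ cong (iter π k) (trans (sym fromTop) (cong π (sym toTop))) ⟩
    iter π k (π (π (inject₁ x)))     ≡⟨ sym (iter-sucʳ π k _) ⟩
    iter π (suc k) (π (inject₁ x))   ≡⟨ sym (iter-sucʳ π (suc k) _) ⟩
    iter π (suc (suc k)) (inject₁ x) ≡⟨ e ⟩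
    inject₁ y                        ∎))

  module _ {j} (πj≡top : π (inject₁ j) ≡ fromℕ m) where

    injective-from-∂ : Injective _≡_ _≡_ (∂ π) → Injective _≡_ _≡_ π
    injective-from-∂ ∂-inj = injective
      where
      misses-top-image : ∀ x → π (inject₁ x) ≢ π (fromℕ m)
      misses-top-image x e with ∂-step x
      ... | inj₂ (hit , _) = top-moves (trans (sym e) hit)
      ... | inj₁ s = top-moves (trans (sym e) (trans (cong (π ∘ inject₁) x≡j) πj≡top))
        where
        x≡j : x ≡ j
        x≡j = ∂-inj (Finₚ.inject₁-injective (trans (sym s) (trans e (sym (∂-skip π j πj≡top top-moves)))))

      injective : Injective _≡_ _≡_ π
      injective {y₁} {y₂} e with view y₁ | view y₂
      ... | ‵fromℕ      | ‵fromℕ      = refl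
      ... | ‵fromℕ      | ‵inject₁ x₂ = contradiction (sym e) (misses-top-image x₂)
      ... | ‵inject₁ x₁ | ‵fromℕ      = contradiction e (misses-top-image x₁)
      ... | ‵inject₁ x₁ | ‵inject₁ x₂ = cong inject₁ (∂-inj (∂-resp e))

    isCyclic-from-∂ : IsCyclic (∂ π) → IsCyclic π
    isCyclic-from-∂ ((∂-inj , _) , ∂-reaches) = injective⇒isPerm (injective-from-∂ ∂-inj) , reaches
      where
      to-inject₁ : ∀ y → ∃ λ x → Reaches π y (inject₁ x)
      to-inject₁ y with view y
      ... | ‵fromℕ     = ∂ π j , reaches-step π (sym (∂-skip π j πj≡top top-moves))
      ... | ‵inject₁ x = x , reaches-refl π
      from-inject₁ : ∀ x y → Reaches π (inject₁ x) y
      from-inject₁ x y with view y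
      ... | ‵fromℕ      = let k , e = ∂-reaches x j in
        reaches-trans π (subst (Reaches π (inject₁ x) ∘ inject₁) e (reaches-iter-∂ k x)) (reaches-step π πj≡top)
      ... | ‵inject₁ y′ = let k , e = ∂-reaches x y′ in
        subst (Reaches π (inject₁ x) ∘ inject₁) e (reaches-iter-∂ k x)
      reaches : ∀ y₁ y₂ → Reaches π y₁ y₂
      reaches y₁ y₂ = let x , r = to-inject₁ y₁ in reaches-trans π r (from-inject₁ x y₂)

insertAfter : ∀ {m} → (Fin m → Fin m) → Fin m → Fin (suc m) → Fin (suc m)
insertAfter {m} ρ j y with view y
... | ‵fromℕ     = inject₁ (ρ j)
... | ‵inject₁ x with x ≟ j
...   | yes _ = fromℕ m
...   | no _  = inject₁ (ρ x)

module _ {m} (ρ : Fin m → Fin m) (j : Fin m) where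

  insertAfter-fromℕ : insertAfter ρ j (fromℕ m) ≡ inject₁ (ρ j)
  insertAfter-fromℕ rewrite view-fromℕ m = refl

  insertAfter-target : insertAfter ρ j (inject₁ j) ≡ fromℕ m
  insertAfter-target rewrite view-inject₁ j with j ≟ j
  ... | yes _  = refl
  ... | no j≢j = contradiction refl j≢j

  insertAfter-inject₁ : ∀ {x} → x ≢ j → insertAfter ρ j (inject₁ x) ≡ inject₁ (ρ x)
  insertAfter-inject₁ {x} x≢j rewrite view-inject₁ x with x ≟ j
  ... | yes x≡j = contradiction x≡j x≢j
  ... | no _    = refl

  insertAfter-moves-top : insertAfter ρ j (fromℕ m) ≢ fromℕ m
  insertAfter-moves-top = inject₁≢fromℕ (ρ j) ∘ trans (sym insertAfter-fromℕ)

  ∂-insertAfter : ∂ (insertAfter ρ j) ≗ ρ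
  ∂-insertAfter x with x ≟ j
  ... | yes refl = Finₚ.inject₁-injective (begin
    inject₁ (∂ (insertAfter ρ j) x) ≡⟨ ∂-skip (insertAfter ρ j) x insertAfter-target insertAfter-moves-top ⟩
    insertAfter ρ j (fromℕ m)       ≡⟨ insertAfter-fromℕ ⟩
    inject₁ (ρ x)                   ∎)
  ... | no x≢j = Finₚ.inject₁-injective (trans (∂-inject₁ (insertAfter ρ j) x misses) (insertAfter-inject₁ x≢j))
    where
    misses : insertAfter ρ j (inject₁ x) ≢ fromℕ m
    misses = inject₁≢fromℕ (ρ x) ∘ trans (sym (insertAfter-inject₁ x≢j))

  insertAfter-isCyclic : IsCyclic ρ → IsCyclic (insertAfter ρ j)
  insertAfter-isCyclic ρ-cyclic =
    isCyclic-from-∂ insertAfter-moves-top {j = j} insertAfter-target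
                    (isCyclic-resp-≗ (sym ∘ ∂-insertAfter) ρ-cyclic)

-- The statistic β = c(n, n+1)

-- β and top-preimage are opaque: letting the type checker unfold the count behind β, or the proof
-- behind top-preimage, during conversion checking makes it blow up.
opaque
  β : ∀ {m} → (Fin (suc (suc m)) → Fin (suc (suc m))) → ℕ
  β {m} π = cζ π (inject₁ (fromℕ m)) (fromℕ (suc m))

  β-unfold : ∀ {m} (π : Fin (suc (suc m)) → Fin (suc (suc m))) →
             β π ≡ cζ π (inject₁ (fromℕ m)) (fromℕ (suc m))
  β-unfold π = refl

  β-cong : ∀ {m} {π π′ : Fin (suc (suc m)) → Fin (suc (suc m))} → π ≗ π′ → β π ≡ β π′
  β-cong {m} π≗π′ = cζ-cong π≗π′ (inject₁ (fromℕ m)) (fromℕ (suc m))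

module _ {m} {π : Fin (suc (suc m)) → Fin (suc (suc m))} (π-cyclic : IsCyclic π) where
  open Cycle π-cyclic

  cycle-moves-top : π (fromℕ (suc m)) ≢ fromℕ (suc m)
  cycle-moves-top = no-fixed-point (inject₁≢fromℕ zero ∘ sym)

  ∂-isCyclic : IsCyclic (∂ π)
  ∂-isCyclic = injective⇒isPerm (∂-injective cycle-moves-top injective) ,
               λ x y → let k , e = reaches (inject₁ x) (inject₁ y) in reaches⇒∂-reaches cycle-moves-top k x y e

  opaque
    top-preimage : ∃ λ d → d < suc m × β π ≡ d × π (inject₁ (iter (∂ π) d (fromℕ m))) ≡ fromℕ (suc m)
    top-preimage = let d , d<N , hits = orbit-index (inject₁ (fromℕ m)) (fromℕ (suc m)) in from-distance d d<N hits
      where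
      from-distance : ∀ d → d < suc (suc m) → iter π d (inject₁ (fromℕ m)) ≡ fromℕ (suc m) →
                      ∃ λ d → d < suc m × β π ≡ d × π (inject₁ (iter (∂ π) d (fromℕ m))) ≡ fromℕ (suc m)
      from-distance zero    _     a≡top = contradiction a≡top (inject₁≢fromℕ _)
      from-distance (suc d) 1+d<N hits  =
        d , s≤s⁻¹ 1+d<N , trans (β-unfold π) (cζ-orbit 1+d<N hits) ,
        trans (cong π (sym (iter-∂ π d (fromℕ m) avoids))) hits
        where
        avoids : ∀ i → i ≤ d → iter π i (inject₁ (fromℕ m)) ≢ fromℕ (suc m)
        avoids i i≤d πⁱa≡top = iter-distinct (s≤s i≤d) 1+d<N (trans πⁱa≡top (sym hits))

β< : ∀ {m} {π : Fin (suc (suc m)) → Fin (suc (suc m))} → IsCyclic π → β π < suc m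
β< π-cyclic = let d , d<1+m , βπ≡d , _ = top-preimage π-cyclic in subst (_< _) (sym βπ≡d) d<1+m

∂-β-injective : ∀ {m} {π π′ : Fin (suc (suc m)) → Fin (suc (suc m))} → IsCyclic π → IsCyclic π′ →
                ∂ π ≗ ∂ π′ → β π ≡ β π′ → π ≗ π′
∂-β-injective {m} {π} {π′} π-cyclic π′-cyclic ∂≗∂′ β≡β′ =
  let d  , _ , βπ≡d   , π-hits  = top-preimage π-cyclic
      d′ , _ , βπ′≡d′ , π′-hits = top-preimage π′-cyclic
  in ∂-determines (Cycle.injective π-cyclic) (Cycle.injective π′-cyclic) ∂≗∂′ π-hits (begin
    π′ (inject₁ (iter (∂ π) d (fromℕ m)))   ≡⟨ cong (π′ ∘ inject₁) (iter-cong ∂≗∂′ d (fromℕ m)) ⟩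
    π′ (inject₁ (iter (∂ π′) d (fromℕ m)))  ≡⟨ cong (λ c → π′ (inject₁ (iter (∂ π′) c (fromℕ m))))
                                                     (trans (sym βπ≡d) (trans β≡β′ βπ′≡d′)) ⟩
    π′ (inject₁ (iter (∂ π′) d′ (fromℕ m))) ≡⟨ π′-hits ⟩
    fromℕ (suc m)                           ∎)

β-insertAfter : ∀ {m} {ρ : Fin (suc m) → Fin (suc m)} {t} → IsCyclic ρ → t < suc m →
                β (insertAfter ρ (iter ρ t (fromℕ m))) ≡ t
β-insertAfter {m} {ρ} {t} ρ-cyclic t<1+m =
  let d , d<1+m , βπ≡d , π-hits = top-preimage π-cyclic
  in trans βπ≡d (Cycle.orbit-index-unique ρ-cyclic d<1+m t<1+m (begin
    iter ρ d (fromℕ m)     ≡⟨ sym (iter-cong (∂-insertAfter ρ j) d (fromℕ m)) ⟩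
    iter (∂ π) d (fromℕ m) ≡⟨ Finₚ.inject₁-injective (Cycle.injective π-cyclic
                                (trans π-hits (sym (insertAfter-target ρ j)))) ⟩
    j                      ∎))
  where
  j : Fin (suc m)
  j = iter ρ t (fromℕ m)
  π : Fin (suc (suc m)) → Fin (suc (suc m))
  π = insertAfter ρ j
  π-cyclic : IsCyclic π
  π-cyclic = insertAfter-isCyclic ρ j ρ-cyclic

-- The map F

α : ℕ → ℕ → ℕ
α n b with n % 2 ℕₚ.≟ 0
... | yes _ = n ∸ b
... | no _  = 1 + b

-- The paper's α for n = k + 2 and β = b, as a 0-based index.
position : ∀ k → ℕ → Fin (suc (suc k))
position k b = toIdx (suc k) (α (suc (suc k)) b)

toℕ-toIdx : ∀ n a → a ∸ 1 < suc n → toℕ (toIdx n a) ≡ a ∸ 1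
toℕ-toIdx n a a-1<1+n with (a ∸ 1) ℕₚ.<? suc n
... | yes p = Finₚ.toℕ-fromℕ< p
... | no ¬p = contradiction a-1<1+n ¬p

toℕ-toIdx-∸ : ∀ n {b} → b ≤ n → toℕ (toIdx n (suc n ∸ b)) ≡ n ∸ b
toℕ-toIdx-∸ n {b} b≤n = trans (toℕ-toIdx n (suc n ∸ b) (subst (_< suc n) (sym n-b) (s≤s (ℕₚ.m∸n≤m n b)))) n-b
  where
  n-b : suc n ∸ b ∸ 1 ≡ n ∸ b
  n-b = cong (_∸ 1) (ℕₚ.+-∸-assoc 1 b≤n)

position-injective : ∀ k {b b′} → b < suc (suc k) → b′ < suc (suc k) →
                     position k b ≡ position k b′ → b ≡ b′
position-injective k {b} {b′} b<2+k b′<2+k e with suc (suc k) % 2 ℕₚ.≟ 0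
... | yes _ = ℕₚ.∸-cancelˡ-≡ (s≤s⁻¹ b<2+k) (s≤s⁻¹ b′<2+k) (begin
  suc k ∸ b                                 ≡⟨ sym (toℕ-toIdx-∸ (suc k) (s≤s⁻¹ b<2+k)) ⟩
  toℕ (toIdx (suc k) (suc (suc k) ∸ b))     ≡⟨ cong toℕ e ⟩
  toℕ (toIdx (suc k) (suc (suc k) ∸ b′))    ≡⟨ toℕ-toIdx-∸ (suc k) (s≤s⁻¹ b′<2+k) ⟩
  suc k ∸ b′                                ∎)
... | no _  = begin
  b                                         ≡⟨ sym (toℕ-toIdx (suc k) (suc b) b<2+k) ⟩
  toℕ (toIdx (suc k) (suc b))               ≡⟨ cong toℕ e ⟩
  toℕ (toIdx (suc k) (suc b′))              ≡⟨ toℕ-toIdx (suc k) (suc b′) b′<2+k ⟩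
  b′                                        ∎

position-surjective : ∀ k (a : Fin (suc (suc k))) → ∃ λ b → b < suc (suc k) × position k b ≡ a
position-surjective k a with suc (suc k) % 2 ℕₚ.≟ 0
... | yes _ = suc k ∸ toℕ a , s≤s (ℕₚ.m∸n≤m (suc k) (toℕ a)) ,
              Finₚ.toℕ-injective (trans (toℕ-toIdx-∸ (suc k) (ℕₚ.m∸n≤m (suc k) (toℕ a)))
                                        (ℕₚ.m∸[m∸n]≡n (s≤s⁻¹ (Finₚ.toℕ<n a))))
... | no _  = toℕ a , Finₚ.toℕ<n a , Finₚ.toℕ-injective (toℕ-toIdx (suc k) (suc (toℕ a)) (Finₚ.toℕ<n a))

-- F keeps its α in a where-block; it is exposed by splitting on the same parity test.
F-fromℕ : ∀ k π → F (suc (suc k)) π (fromℕ (suc k)) ≡ position k (β π)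
F-fromℕ k π = trans unfolded (cong (position k) (sym (β-unfold π)))
  where
  unfolded : F (suc (suc k)) π (fromℕ (suc k)) ≡
             position k (cζ π (inject₁ (fromℕ (suc k))) (fromℕ (suc (suc k))))
  unfolded with suc (suc k) % 2 ℕₚ.≟ 0
  ... | yes _ = Dinv-fromℕ _ _
  ... | no _  = Dinv-fromℕ _ _

F-inject₁ : ∀ k π x → F (suc (suc k)) π (inject₁ x) ≡
                      punchIn (F (suc (suc k)) π (fromℕ (suc k))) (F (suc k) (∂ π) x)
F-inject₁ k π x = trans (Dinv-inject₁ _ _ x) (cong (λ a → punchIn a (F (suc k) (∂ π) x)) (sym (Dinv-fromℕ _ _)))

F-step : ∀ k π → F (suc (suc k)) π ≗ Dinv (F (suc k) (∂ π)) (position k (β π))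
F-step k π y with view y
... | ‵fromℕ     = trans (F-fromℕ k π) (sym (Dinv-fromℕ _ _))
... | ‵inject₁ x = begin
  F (suc (suc k)) π (inject₁ x)
    ≡⟨ F-inject₁ k π x ⟩
  punchIn (F (suc (suc k)) π (fromℕ (suc k))) (F (suc k) (∂ π) x)
    ≡⟨ cong (λ a → punchIn a (F (suc k) (∂ π) x)) (F-fromℕ k π) ⟩
  punchIn (position k (β π)) (F (suc k) (∂ π) x)
    ≡⟨ sym (Dinv-inject₁ _ _ x) ⟩
  Dinv (F (suc k) (∂ π)) (position k (β π)) (inject₁ x)
    ∎

F-cong : ∀ k {π π′ : Fin (suc (suc k)) → Fin (suc (suc k))} → π ≗ π′ → F (suc k) π ≗ F (suc k) π′
F-cong zero    π≗π′ x = refl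
F-cong (suc k) {π} {π′} π≗π′ x = begin
  F (suc (suc k)) π x
    ≡⟨ F-step k π x ⟩
  Dinv (F (suc k) (∂ π)) (position k (β π)) x
    ≡⟨ Dinv-cong (F-cong k (∂-cong π≗π′)) (cong (position k) (β-cong π≗π′)) x ⟩
  Dinv (F (suc k) (∂ π′)) (position k (β π′)) x
    ≡⟨ sym (F-step k π′ x) ⟩
  F (suc (suc k)) π′ x
    ∎

F-isPerm : ∀ k π → IsPerm (F (suc k) π)
F-isPerm zero    π = injective⇒isPerm id
F-isPerm (suc k) π = injective⇒isPerm λ {x} {y} e →
  Dinv-injective _ _ (proj₁ (F-isPerm k (∂ π))) (trans (sym (F-step k π x)) (trans e (F-step k π y)))

F-injective : ∀ k {π π′ : Fin (suc (suc k)) → Fin (suc (suc k))} → IsCyclic π → IsCyclic π′ →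
              F (suc k) π ≗ F (suc k) π′ → π ≗ π′
F-injective zero    π-cyclic π′-cyclic _ = cycles-on-Fin2-coincide π-cyclic π′-cyclic
F-injective (suc k) {π} {π′} π-cyclic π′-cyclic F≗F′ =
  let F∂≗F∂′ , position≡ = Dinv-cancel (λ y → trans (sym (F-step k π y)) (trans (F≗F′ y) (F-step k π′ y)))
  in ∂-β-injective π-cyclic π′-cyclic
       (F-injective k (∂-isCyclic π-cyclic) (∂-isCyclic π′-cyclic) F∂≗F∂′)
       (position-injective k (β< π-cyclic) (β< π′-cyclic) position≡)

F-surjective : ∀ k (σ : Fin (suc k) → Fin (suc k)) → Injective _≡_ _≡_ σ →
               ∃ λ π → IsCyclic π × F (suc k) π ≗ σ
F-surjective zero σ _ = insertAfter id zero , insertAfter-isCyclic id zero id-isCyclic , λ { zero → only-point }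
  where
  id-isCyclic : IsCyclic {1} id
  id-isCyclic = injective⇒isPerm id , λ { zero zero → reaches-refl id }
  only-point : zero ≡ σ zero
  only-point with σ zero
  ... | zero = refl
F-surjective (suc k) σ σ-inj =
  let τ , τ-inj , Dτ≗σ = Dinv-surjective σ-inj
      ρ , ρ-cyclic , Fρ≗τ = F-surjective k τ τ-inj
      t , t<2+k , position≡ = position-surjective k (σ (fromℕ (suc k)))
      j = iter ρ t (fromℕ (suc k))
  in insertAfter ρ j , insertAfter-isCyclic ρ j ρ-cyclic , λ y → begin
    F (suc (suc k)) (insertAfter ρ j) y
      ≡⟨ F-step k (insertAfter ρ j) y ⟩
    Dinv (F (suc k) (∂ (insertAfter ρ j))) (position k (β (insertAfter ρ j))) y
      ≡⟨ Dinv-cong (λ x → trans (F-cong k (∂-insertAfter ρ j) x) (Fρ≗τ x))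
                   (trans (cong (position k) (β-insertAfter ρ-cyclic t<2+k)) position≡) y ⟩
    Dinv τ (σ (fromℕ (suc k))) y
      ≡⟨ Dτ≗σ y ⟩
    σ y
      ∎

lemma1 : (n : ℕ) → 1 ≤ n →
    ((π : Fin (suc n) → Fin (suc n)) → IsCyclic π → IsPerm (F n π))
    × ((π π′ : Fin (suc n) → Fin (suc n)) → IsCyclic π → IsCyclic π′ →
         F n π ≗ F n π′ → π ≗ π′)
    × ((σ : Fin n → Fin n) → IsPerm σ →
         ∃ λ (π : Fin (suc n) → Fin (suc n)) → IsCyclic π × F n π ≗ σ)
lemma1 (suc k) _ =
  (λ π _ → F-isPerm k π) ,
  (λ π π′ → F-injective k) ,
  (λ σ σ-perm → F-surjective k σ (proj₁ σ-perm))
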